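{- Let $\phi=\frac{1+\sqrt5}2$, $a_1(n)=\lfloor n\phi\rfloor$, $a_2(n)=\lfloor n(\phi+1)\rfloor$, $b_1(n)=a_1(n)+g(n)-1$, $b_2(n)=a_2(n)+g(n)$, where $g$ is as in the context. Let $n,m\in\mathbb{N}$ satisfy $a_1(n)=a_1(n-1)+1=a_2(m)+2$. Then one of the following holds: (i) $\lfloor n\phi\rfloor=b_1(n)$, $\lfloor n\phi\rfloor-1=b_1(n-1)$, and $b_2(m)<b_1(n-1)<b_1(n)<b_2(m+1)$; (ii) $\lfloor n\phi\rfloor=b_1(n)$, $\lfloor n\phi\rfloor-1=b_2(m)$, and $b_1(n-1)<b_2(m)<b_1(n)<b_2(m+1)$.
   Context: $g:\mathbb{Z}_{\geq0}\to\{0,1\}$ is defined by $g(0)=1$, $g(1)=0$ and, for $n\ge2$, $g(n)=1-g(m)$ if there is $m\in\mathbb{Z}_{\geq0}$ with $\lfloor n\phi\rfloor=\lfloor m(\phi+1)\rfloor+1$, and $g(n)=1$ otherwise. $\mathbb{N}$ denotes the positive integers. -}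

module Defs where

open import Data.Nat using (ℕ; zero; suc; _+_; _*_; _∸_; _/_; _≤?_; _≟_)
open import Data.Maybe using (Maybe; just; nothing)
open import Relation.Nullary.Decidable using (does)
open import Data.Bool using (Bool; true; false; if_then_else_)

isqrt : ℕ → ℕ
isqrt zero = zero
isqrt (suc n) with isqrt n
... | r = if does (suc r * suc r ≤? suc n) then suc r else r

-- a₁(n) = ⌊ n φ ⌋ with φ = (1 + √5)/2.
-- Exactly: ⌊ n φ ⌋ = ⌊ (n + √(5n²)) / 2 ⌋ = ⌊ (n + ⌊√(5n²)⌋) / 2 ⌋.
a₁ : ℕ → ℕ
a₁ n = (n + isqrt (5 * (n * n))) / 2

-- a₂(n) = ⌊ n (φ + 1) ⌋ = ⌊ n φ ⌋ + n
a₂ : ℕ → ℕ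
a₂ n = a₁ n + n

search : ℕ → ℕ → Maybe ℕ
search n k = go k 0
  where
  go : ℕ → ℕ → Maybe ℕ
  go zero i = nothing
  go (suc f) i = if does (a₁ n ≟ a₂ i + 1) then just i else go f (suc i)

-- g with fuel; any m with ⌊nφ⌋ = ⌊m(φ+1)⌋ + 1 satisfies m < n (since
-- m φ² ≤ n φ), and such m is unique (a₂ strictly increasing), so
-- searching m < n is exactly the defining clause; fuel n+1 suffices.
gF : ℕ → ℕ → ℕ
gF zero n = 1
gF (suc f) zero = 1
gF (suc f) (suc zero) = 0
gF (suc f) (suc (suc k)) with search (suc (suc k)) (suc (suc k))
... | just m = 1 ∸ gF f m
... | nothing = 1

g : ℕ → ℕ
g n = gF (suc n) n

b₁ : ℕ → ℕ
b₁ n = a₁ n + g n ∸ 1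

b₂ : ℕ → ℕ
b₂ n = a₂ n + g n

{-# OPTIONS --safe #-}
-- Put A = a₂ m, so that a₁ (n − 1) = A + 1 and a₁ n = A + 2. The first gives g (n − 1) = 1 − g m.
-- Since a₂ grows by at least 2 no a₂ value is A + 1, so g n = 1; and a₂ (m + 1) ≠ A + 2 = a₁ n
-- because the Beatty sequences a₁ and a₂ are disjoint, so a₂ (m + 1) ≥ A + 3. Hence b₁ n = A + 2
-- and {b₁ (n − 1), b₂ m} = {A, A + 1}, ordered by g m.
-- Everything about a₁ follows from x ≤ a₁ k ⇔ x² ≤ x k + k², i.e. x ≤ k φ. Disjointness reduces,
-- through 1 + 1 / φ = φ, to a solution of x² = x y + y² with y > 0, which descent excludes.
module Submission where

open import Defs
open import Data.Bool using (true; false; if_then_else_)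
open import Data.Empty using (⊥-elim)
open import Data.Maybe using (Maybe; just; nothing)
open import Data.Maybe.Properties using (just-injective)
open import Data.Nat using (ℕ; NonZero; zero; suc; _+_; _*_; _∸_; _/_; _<_; _≤_; z≤n; s≤s; s≤s⁻¹; z<s; _≤?_; _≟_)
open import Data.Nat.DivMod using (m/n*n≤m; m*n/n≡m; /-monoˡ-≤)
open import Data.Nat.Induction using (<-wellFounded)
open import Data.Nat.Properties
open import Data.Nat.Tactic.RingSolver using (solve-∀)
open import Data.Product using (_×_; _,_; proj₁; proj₂)
open import Data.Sum using (_⊎_; inj₁; inj₂)
import Data.Sum as Sum
open import Function.Base using (_∘_)
open import Function.Bundles using (_⇔_; mk⇔; Equivalence)
open import Function.Properties.Equivalence using () renaming (sym to ⇔-sym)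
open import Function.Related.Propositional using (module EquationalReasoning; equivalence)
open import Induction.WellFounded using (Acc; acc)
open import Relation.Binary using (tri<; tri≈; tri>)
open import Relation.Binary.PropositionalEquality
  using (_≡_; _≢_; refl; sym; trans; cong; cong₂; subst; subst₂; module ≡-Reasoning)
open import Relation.Nullary using (¬_; yes; no; does; proof; ofʸ; ofⁿ)

+-cancelˡ-≤⇔ : ∀ a {b c} → a + b ≤ a + c ⇔ b ≤ c
+-cancelˡ-≤⇔ a = mk⇔ (+-cancelˡ-≤ a _ _) (+-monoʳ-≤ a)

∸≤⇔≤+ : ∀ m n {o} → m ∸ n ≤ o ⇔ m ≤ n + o
∸≤⇔≤+ m n = mk⇔ (λ m∸n≤o → ≤-trans (m≤n+m∸n m n) (+-monoʳ-≤ n m∸n≤o)) (m≤n+o⇒m∸n≤o m n)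

*-cancelˡ-≤⇔ : ∀ o .{{_ : NonZero o}} {m n} → o * m ≤ o * n ⇔ m ≤ n
*-cancelˡ-≤⇔ o = mk⇔ (*-cancelˡ-≤ o) (*-monoʳ-≤ o)

+-sq≤⇔ : ∀ k d → d * d ≤ 5 * (k * k) ⇔ (k + d) * (k + d) ≤ 2 * (k + d) * k + 4 * (k * k)
+-sq≤⇔ k d = subst₂ (λ l r → d * d ≤ 5 * (k * k) ⇔ l ≤ r) (sym (expand-lhs k d)) (sym (expand-rhs k d))
  (⇔-sym (+-cancelˡ-≤⇔ (k * k + 2 * k * d)))
  where
  expand-lhs : ∀ k d → (k + d) * (k + d) ≡ (k * k + 2 * k * d) + d * d
  expand-lhs = solve-∀
  expand-rhs : ∀ k d → 2 * (k + d) * k + 4 * (k * k) ≡ (k * k + 2 * k * d) + 5 * (k * k)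
  expand-rhs = solve-∀

∸-sq≤⇔ : ∀ y k → (y ∸ k) * (y ∸ k) ≤ 5 * (k * k) ⇔ y * y ≤ 2 * y * k + 4 * (k * k)
∸-sq≤⇔ y k with ≤-total y k
... | inj₁ y≤k = mk⇔ (λ _ → ≤-trans (*-mono-≤ (m≤n*m y 2) y≤k) (m≤m+n _ _))
                     (λ _ → subst (λ d → d * d ≤ 5 * (k * k)) (sym (m≤n⇒m∸n≡0 y≤k)) z≤n)
... | inj₂ k≤y with m≤n⇒∃[o]m+o≡n k≤y
...   | d , refl rewrite m+n∸m≡n k d = +-sq≤⇔ k d

isqrt-bounds : ∀ n → isqrt n * isqrt n ≤ n × n < suc (isqrt n) * suc (isqrt n)
isqrt-bounds zero = z≤n , s≤s z≤n
isqrt-bounds (suc n) with isqrt n | isqrt-bounds n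
... | r | (r²≤n , n<[1+r]²) with does (suc r * suc r ≤? suc n) | proof (suc r * suc r ≤? suc n)
...   | true  | ofʸ [1+r]²≤1+n = [1+r]²≤1+n , ≤-<-trans n<[1+r]² (*-mono-< (n<1+n (suc r)) (n<1+n (suc r)))
...   | false | ofⁿ [1+r]²≰1+n = m≤n⇒m≤1+n r²≤n , ≰⇒> [1+r]²≰1+n

≤isqrt⇔ : ∀ {x} n → x ≤ isqrt n ⇔ x * x ≤ n
≤isqrt⇔ {x} n with isqrt-bounds n
... | r²≤n , n<[1+r]² = mk⇔
  (λ x≤r → ≤-trans (*-mono-≤ x≤r x≤r) r²≤n)
  (λ x²≤n → ≮⇒≥ λ r<x → <⇒≱ n<[1+r]² (≤-trans (*-mono-≤ r<x r<x) x²≤n))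

≤/2⇔ : ∀ {x} n → x ≤ n / 2 ⇔ x * 2 ≤ n
≤/2⇔ {x} n = mk⇔
  (λ x≤n/2 → ≤-trans (*-monoˡ-≤ 2 x≤n/2) (m/n*n≤m n 2))
  (λ 2x≤n → subst (_≤ n / 2) (m*n/n≡m x 2) (/-monoˡ-≤ 2 2x≤n))

infix 4 _≤φ_ _≥φ_

-- x ≤φ y and x ≥φ y encode x ≤ φ y and x ≥ φ y, φ being the positive root of t² = t + 1:
-- for naturals, x ≤ φ y iff x² ≤ x y + y².
_≤φ_ : ℕ → ℕ → Set
x ≤φ y = x * x ≤ x * y + y * y

_≥φ_ : ℕ → ℕ → Set
x ≥φ y = x * y + y * y ≤ x * x

≤a₁⇔≤φ : ∀ x k → x ≤ a₁ k ⇔ x ≤φ k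
≤a₁⇔≤φ x k = begin
  x ≤ a₁ k                                            ∼⟨ ≤/2⇔ (k + s) ⟩
  x * 2 ≤ k + s                                       ∼⟨ ⇔-sym (∸≤⇔≤+ (x * 2) k) ⟩
  x * 2 ∸ k ≤ s                                       ∼⟨ ≤isqrt⇔ (5 * (k * k)) ⟩
  (x * 2 ∸ k) * (x * 2 ∸ k) ≤ 5 * (k * k)             ∼⟨ ∸-sq≤⇔ (x * 2) k ⟩
  (x * 2) * (x * 2) ≤ 2 * (x * 2) * k + 4 * (k * k)   ≡⟨ cong₂ _≤_ (quadruple-lhs x) (quadruple-rhs x k) ⟩
  4 * (x * x) ≤ 4 * (x * k + k * k)                   ∼⟨ *-cancelˡ-≤⇔ 4 ⟩
  x ≤φ k                                              ∎
  where
  open EquationalReasoning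
  s = isqrt (5 * (k * k))
  quadruple-lhs : ∀ x → (x * 2) * (x * 2) ≡ 4 * (x * x)
  quadruple-lhs = solve-∀
  quadruple-rhs : ∀ x k → 2 * (x * 2) * k + 4 * (k * k) ≡ 4 * (x * k + k * k)
  quadruple-rhs = solve-∀

a₁-≤φ : ∀ k → a₁ k ≤φ k
a₁-≤φ k = Equivalence.to (≤a₁⇔≤φ (a₁ k) k) ≤-refl

1+a₁-≰φ : ∀ k → ¬ suc (a₁ k) ≤φ k
1+a₁-≰φ k h = <-irrefl refl (Equivalence.from (≤a₁⇔≤φ (suc (a₁ k)) k) h)

≤φ-monoʳ : ∀ {x y z} → y ≤ z → x ≤φ y → x ≤φ z
≤φ-monoʳ {x} y≤z x≤φy = ≤-trans x≤φy (+-mono-≤ (*-monoʳ-≤ x y≤z) (*-mono-≤ y≤z y≤z))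

≤φ⇒≤k+k : ∀ {x k} → x ≤φ k → x ≤ k + k
≤φ⇒≤k+k {x} {k} x≤φk = ≮⇒≥ λ 2k<x → <⇒≱ (begin-strict
  x * k + k * k      ≤⟨ +-monoʳ-≤ (x * k) (*-monoˡ-≤ k (≤-trans (m≤m+n k k) (<⇒≤ 2k<x))) ⟩
  x * k + x * k      <⟨ m<n+m (x * k + x * k) (≤-trans z<s 2k<x) ⟩
  x + (x * k + x * k) ≡⟨ solve-x*[1+2k] x k ⟩
  x * suc (k + k)    ≤⟨ *-monoʳ-≤ x 2k<x ⟩
  x * x              ∎) x≤φk
  where
  open ≤-Reasoning
  solve-x*[1+2k] : ∀ x k → x + (x * k + x * k) ≡ x * suc (k + k)
  solve-x*[1+2k] = solve-∀

≤φ-suc : ∀ {x k} → x ≤φ k → suc x ≤φ suc k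
≤φ-suc {x} {k} x≤φk = subst₂ _≤_ (sym (expand-lhs x)) (sym (expand-rhs x k))
  (+-mono-≤ x≤φk (+-monoʳ-≤ (suc x) (m≤n⇒m≤n+o (suc k) (≤φ⇒≤k+k x≤φk))))
  where
  expand-lhs : ∀ x → suc x * suc x ≡ x * x + (suc x + x)
  expand-lhs = solve-∀
  expand-rhs : ∀ x k → suc x * suc k + suc k * suc k ≡ (x * k + k * k) + (suc x + (k + k + suc k))
  expand-rhs = solve-∀

a₁-mono-≤ : ∀ {i j} → i ≤ j → a₁ i ≤ a₁ j
a₁-mono-≤ {i} {j} i≤j = Equivalence.from (≤a₁⇔≤φ (a₁ i) j) (≤φ-monoʳ {a₁ i} i≤j (a₁-≤φ i))

a₁-suc : ∀ k → a₁ k < a₁ (suc k)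
a₁-suc k = Equivalence.from (≤a₁⇔≤φ (suc (a₁ k)) (suc k)) (≤φ-suc {a₁ k} (a₁-≤φ k))

a₂-mono-≤ : ∀ {i j} → i ≤ j → a₂ i ≤ a₂ j
a₂-mono-≤ i≤j = +-mono-≤ (a₁-mono-≤ i≤j) i≤j

a₂-gap : ∀ {i j} → i < j → a₂ i + 2 ≤ a₂ j
a₂-gap {i} {j} i<j = begin
  a₁ i + i + 2          ≡⟨ solve-+2 (a₁ i) i ⟩
  suc (a₁ i) + suc i    ≤⟨ +-monoˡ-≤ (suc i) (a₁-suc i) ⟩
  a₁ (suc i) + suc i    ≤⟨ a₂-mono-≤ i<j ⟩
  a₂ j                  ∎
  where
  open ≤-Reasoning
  solve-+2 : ∀ a i → a + i + 2 ≡ suc a + suc i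
  solve-+2 = solve-∀

a₂-injective : ∀ {i j} → a₂ i ≡ a₂ j → i ≡ j
a₂-injective {i} {j} a₂i≡a₂j with <-cmp i j
... | tri< i<j _ _ = ⊥-elim (m+1+n≰m (a₂ i) (subst (a₂ i + 2 ≤_) (sym a₂i≡a₂j) (a₂-gap i<j)))
... | tri≈ _ i≡j _ = i≡j
... | tri> _ _ j<i = ⊥-elim (m+1+n≰m (a₂ j) (subst (a₂ j + 2 ≤_) a₂i≡a₂j (a₂-gap j<i)))

a₂-skips : ∀ i m → a₂ i ≢ a₂ m + 1
a₂-skips i m a₂i≡a₂m+1 with i ≤? m
... | yes i≤m = <-irrefl a₂i≡a₂m+1 (≤-<-trans (a₂-mono-≤ i≤m) (m<m+n (a₂ m) z<s))
... | no  i≰m = m+1+n≰m (a₂ m + 1) (subst₂ _≤_ (sym (+-assoc (a₂ m) 1 1)) a₂i≡a₂m+1 (a₂-gap (≰⇒> i≰m)))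

-- x ≤ φ p iff x + p ≥ x + x / φ = φ x, as 1 + 1 / φ = φ.
+≥φ⇔≤φ : ∀ x p → x + p ≥φ x ⇔ x ≤φ p
+≥φ⇔≤φ x p = subst₂ (λ l r → l ≤ r ⇔ x ≤φ p) (sym (expand-lhs x p)) (sym (expand-rhs x p))
  (+-cancelˡ-≤⇔ (x * x + x * p))
  where
  expand-lhs : ∀ x p → (x + p) * x + x * x ≡ (x * x + x * p) + x * x
  expand-lhs = solve-∀
  expand-rhs : ∀ x p → (x + p) * (x + p) ≡ (x * x + x * p) + (x * p + p * p)
  expand-rhs = solve-∀

xy+y²-mono-< : ∀ x {y z} → y < z → x * y + y * y < x * z + z * z
xy+y²-mono-< x y<z = +-mono-≤-< (*-monoʳ-≤ x (<⇒≤ y<z)) (*-mono-< y<z y<z)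

≥φ-≤φ⇒≤ : ∀ {x q n} → x ≥φ q → x ≤φ n → q ≤ n
≥φ-≤φ⇒≤ {x} x≥φq x≤φn = ≮⇒≥ λ n<q → <⇒≱ (xy+y²-mono-< x n<q) (≤-trans x≥φq x≤φn)

≰φ-≱φ⇒< : ∀ {x n y} → ¬ x ≤φ n → ¬ x ≥φ y → n < y
≰φ-≱φ⇒< {x} x≰φn x≱φy = ≰⇒> λ y≤n →
  <-irrefl refl (≤-<-trans (xy+y²-mono-≤ y≤n) (<-trans (≰⇒> x≰φn) (≰⇒> x≱φy)))
  where
  xy+y²-mono-≤ : ∀ {y n} → y ≤ n → x * y + y * y ≤ x * n + n * n
  xy+y²-mono-≤ y≤n = +-mono-≤ (*-monoʳ-≤ x y≤n) (*-mono-≤ y≤n y≤n)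

φ-descent : ∀ y d → (y + d) * (y + d) ≡ (y + d) * y + y * y → y * y ≡ y * d + d * d
φ-descent y d eq = sym (+-cancelˡ-≡ (y * y + y * d) _ _ (begin
  (y * y + y * d) + (y * d + d * d)   ≡⟨ expand-lhs y d ⟩
  (y + d) * (y + d)                   ≡⟨ eq ⟩
  (y + d) * y + y * y                 ≡⟨ expand-rhs y d ⟩
  (y * y + y * d) + y * y             ∎))
  where
  open ≡-Reasoning
  expand-lhs : ∀ y d → (y * y + y * d) + (y * d + d * d) ≡ (y + d) * (y + d)
  expand-lhs = solve-∀
  expand-rhs : ∀ y d → (y + d) * y + y * y ≡ (y * y + y * d) + y * y
  expand-rhs = solve-∀

-- Descent: a solution (x, y) with y > 0 has y < x and yields the smaller solution (y, x − y).
φ-irrational : ∀ x y → x * x ≡ x * y + y * y → y ≡ 0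
φ-irrational x y = descend (<-wellFounded x)
  where
  root-gap : ∀ {x y} → x * x ≡ x * suc y + suc y * suc y → suc y < x
  root-gap {x} {y} eq = ≰⇒> λ x≤1+y → <-irrefl eq (≤-<-trans (*-monoʳ-≤ x x≤1+y) (m<m+n (x * suc y) z<s))

  descend : ∀ {x y} → Acc _<_ x → x * x ≡ x * y + y * y → y ≡ 0
  descend {y = zero} _ _ = refl
  descend {x} {suc y} (acc smaller) eq with m≤n⇒∃[o]m+o≡n (<⇒≤ (root-gap {x} {y} eq))
  ... | d , refl with descend {y = d} (smaller (root-gap eq)) (φ-descent (suc y) d eq)
  ...   | refl = ⊥-elim (<-irrefl (sym (+-identityʳ (suc y))) (root-gap eq))

-- With q = a₁ p: φ q ≤ q + p = a₁ n ≤ φ n < a₁ n + 1 < φ (q + 1), so n = q and a₁ n = φ n exactly.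
a₁≡a₂⇒≡0 : ∀ {n p} → a₁ n ≡ a₂ p → n ≡ 0
a₁≡a₂⇒≡0 {n} {p} a₁n≡a₂p = φ-irrational (a₁ n) n (≤-antisym (a₁-≤φ n) a₁n≥φn)
  where
  q = a₁ p
  a₁n≥φq : a₁ n ≥φ q
  a₁n≥φq = subst (_≥φ q) (sym a₁n≡a₂p) (Equivalence.from (+≥φ⇔≤φ q p) (a₁-≤φ p))
  1+a₁n≱φ1+q : ¬ suc (a₁ n) ≥φ suc q
  1+a₁n≱φ1+q = subst (λ J → ¬ suc J ≥φ suc q) (sym a₁n≡a₂p) (1+a₁-≰φ p ∘ Equivalence.to (+≥φ⇔≤φ (suc q) p))
  n≡q : n ≡ q
  n≡q = ≤-antisym (s≤s⁻¹ (≰φ-≱φ⇒< {suc (a₁ n)} (1+a₁-≰φ n) 1+a₁n≱φ1+q)) (≥φ-≤φ⇒≤ {a₁ n} a₁n≥φq (a₁-≤φ n))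
  a₁n≥φn : a₁ n ≥φ n
  a₁n≥φn = subst (a₁ n ≥φ_) (sym n≡q) a₁n≥φq

a₁≡a₂+1⇒< : ∀ {n m} → a₁ n ≡ a₂ m + 1 → m < n
a₁≡a₂+1⇒< {n} {m} hit = ≰⇒> λ n≤m →
  <-irrefl hit (≤-<-trans (≤-trans (a₁-mono-≤ n≤m) (m≤m+n (a₁ m) m)) (m<m+n (a₂ m) z<s))

-- The loop of search is local to its where block and cannot be named; searchFrom is defined
-- as that loop by letting unification solve the meta in search-unfold.
mutual
  searchFrom : (n k fuel i : ℕ) → Maybe ℕ
  searchFrom = _

  search-unfold : ∀ n k →
    search n (suc k) ≡ (if does (a₁ n ≟ a₂ 0 + 1) then just 0 else searchFrom n (suc k) k 1)
  search-unfold n k with suc k | 1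
  ... | _ | _ = refl

searchFrom-sound : ∀ {n k f i m} → searchFrom n k f i ≡ just m → a₁ n ≡ a₂ m + 1 × m < i + f
searchFrom-sound {f = zero} ()
searchFrom-sound {n} {k} {suc f} {i} {m} with does (a₁ n ≟ a₂ i + 1) | proof (a₁ n ≟ a₂ i + 1)
... | true  | ofʸ hit = λ { refl → hit , m<m+n i z<s }
... | false | _ = λ found → let hit , m<1+i+f = searchFrom-sound {n} {k} {f} {suc i} found
                          in hit , subst (m <_) (sym (+-suc i f)) m<1+i+f

searchFrom-complete : ∀ {n k f i m} → a₁ n ≡ a₂ m + 1 → i ≤ m → m < i + f → searchFrom n k f i ≡ just m
searchFrom-complete {f = zero} {i} hit i≤m m<i+0 = ⊥-elim (<⇒≱ (subst (_ <_) (+-identityʳ i) m<i+0) i≤m)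
searchFrom-complete {n} {k} {suc f} {i} {m} hit i≤m m<i+1+f with does (a₁ n ≟ a₂ i + 1) | proof (a₁ n ≟ a₂ i + 1)
... | true  | ofʸ hitᵢ = cong just (a₂-injective (+-cancelʳ-≡ 1 (a₂ i) (a₂ m) (trans (sym hitᵢ) hit)))
... | false | ofⁿ missᵢ =
  searchFrom-complete {n} {k} {f} {suc i} hit (≤∧≢⇒< i≤m λ { refl → missᵢ hit }) (subst (m <_) (+-suc i f) m<i+1+f)

search-sound : ∀ {n k m} → search n k ≡ just m → a₁ n ≡ a₂ m + 1 × m < k
search-sound {n} {k} = searchFrom-sound {n} {k} {k} {0}

search-complete : ∀ {n m} → a₁ n ≡ a₂ m + 1 → search n n ≡ just m
search-complete {n} {m} hit = searchFrom-complete {n} {n} {n} {0} hit z≤n (a₁≡a₂+1⇒< {n} {m} hit)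

gF-fuel-irrelevant : ∀ {f f′ k} → k < f → k < f′ → gF f k ≡ gF f′ k
gF-fuel-irrelevant {suc f} {suc f′} {zero} _ _ = refl
gF-fuel-irrelevant {suc f} {suc f′} {suc zero} _ _ = refl
gF-fuel-irrelevant {suc f} {suc f′} {suc (suc j)} k<1+f k<1+f′ with search (suc (suc j)) (suc (suc j)) in found
... | nothing = refl
... | just m = cong (1 ∸_) (gF-fuel-irrelevant (<-≤-trans m<k (s≤s⁻¹ k<1+f)) (<-≤-trans m<k (s≤s⁻¹ k<1+f′)))
  where
  m<k : m < suc (suc j)
  m<k = proj₂ (search-sound {suc (suc j)} {suc (suc j)} found)

gF-binary : ∀ f k → gF f k ≡ 0 ⊎ gF f k ≡ 1
gF-binary zero k = inj₂ refl
gF-binary (suc f) zero = inj₂ refl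
gF-binary (suc f) (suc zero) = inj₁ refl
gF-binary (suc f) (suc (suc j)) with search (suc (suc j)) (suc (suc j))
... | nothing = inj₂ refl
... | just m with gF-binary f m
...   | inj₁ gF≡0 = inj₂ (cong (1 ∸_) gF≡0)
...   | inj₂ gF≡1 = inj₁ (cong (1 ∸_) gF≡1)

g-flip : ∀ {n m} → 2 ≤ n → a₁ n ≡ a₂ m + 1 → g n ≡ 1 ∸ g m
g-flip {suc (suc k)} {m} (s≤s (s≤s _)) hit with search (suc (suc k)) (suc (suc k)) in found
... | nothing = ⊥-elim (nothing≢just (trans (sym found) (search-complete {suc (suc k)} {m} hit)))
  where
  nothing≢just : nothing ≢ just m
  nothing≢just ()
... | just m′ = cong (1 ∸_) (trans
  (cong (gF (suc (suc k))) (just-injective (trans (sym found) (search-complete {suc (suc k)} {m} hit))))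
  (gF-fuel-irrelevant {suc (suc k)} {suc m} {m} (a₁≡a₂+1⇒< {suc (suc k)} {m} hit) (n<1+n m)))

g-miss : ∀ {n} → 2 ≤ n → (∀ m → a₁ n ≢ a₂ m + 1) → g n ≡ 1
g-miss {suc (suc k)} (s≤s (s≤s _)) miss with search (suc (suc k)) (suc (suc k)) in found
... | nothing = refl
... | just m = ⊥-elim (miss m (proj₁ (search-sound {suc (suc k)} {suc (suc k)} found)))

b₁-g≡1 : ∀ {n} → g n ≡ 1 → b₁ n ≡ a₁ n
b₁-g≡1 {n} g≡1 = trans (cong (λ c → a₁ n + c ∸ 1) g≡1) (m+n∸n≡m (a₁ n) 1)

b₁-g≡0 : ∀ {n} → g n ≡ 0 → b₁ n ≡ a₁ n ∸ 1
b₁-g≡0 {n} g≡0 = cong (_∸ 1) (trans (cong (a₁ n +_) g≡0) (+-identityʳ (a₁ n)))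

-- Here n is the theorem's n − 1. With {X, Y} = {b₂ m, b₁ n} = {a₂ m, a₂ m + 1}, ordered by g m,
-- this is either case of the theorem.
staircase : ∀ {n m X Y} → a₁ n ≡ a₂ m + 1 → a₁ (suc n) ≡ a₁ n + 1 → X ≡ a₂ m → Y ≡ a₁ n →
  a₁ (suc n) ≡ b₁ (suc n) × a₁ (suc n) ∸ 1 ≡ Y × X < Y × Y < b₁ (suc n) × b₁ (suc n) < b₂ (suc m)
staircase {n} {m} hit step refl refl =
  sym b₁≡a₁ ,
  trans (cong (_∸ 1) step) (m+n∸n≡m (a₁ n) 1) ,
  subst (a₂ m <_) (sym hit) (m<m+n (a₂ m) z<s) ,
  subst (a₁ n <_) (sym b₁≡a₁) (a₁-suc n) ,
  subst (_< b₂ (suc m)) (sym b₁≡a₁) (<-≤-trans a₁<a₂ (m≤m+n (a₂ (suc m)) (g (suc m))))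
  where
  hit′ : a₁ (suc n) ≡ a₂ m + 2
  hit′ = trans step (trans (cong (_+ 1) hit) (+-assoc (a₂ m) 1 1))
  b₁≡a₁ : b₁ (suc n) ≡ a₁ (suc n)
  b₁≡a₁ = b₁-g≡1 {suc n} (g-miss {suc n} (s≤s (≤-<-trans z≤n (a₁≡a₂+1⇒< {n} {m} hit))) λ i hitᵢ →
    a₂-skips i m (+-cancelʳ-≡ 1 (a₂ i) (a₂ m + 1) (trans (sym hitᵢ) (trans hit′ (sym (+-assoc (a₂ m) 1 1))))))
  a₁<a₂ : a₁ (suc n) < a₂ (suc m)
  a₁<a₂ = ≤∧≢⇒< (subst (_≤ a₂ (suc m)) (sym hit′) (a₂-gap {m} {suc m} (n<1+n m))) (1+n≢0 ∘ a₁≡a₂⇒≡0 {suc n} {suc m})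

lemma3p4 : (n m : ℕ) → 1 ≤ n → 1 ≤ m →
    a₁ n ≡ a₁ (n ∸ 1) + 1 → a₁ (n ∸ 1) + 1 ≡ a₂ m + 2 →
    (a₁ n ≡ b₁ n × a₁ n ∸ 1 ≡ b₁ (n ∸ 1) ×
      b₂ m < b₁ (n ∸ 1) × b₁ (n ∸ 1) < b₁ n × b₁ n < b₂ (suc m))
    ⊎
    (a₁ n ≡ b₁ n × a₁ n ∸ 1 ≡ b₂ m ×
      b₁ (n ∸ 1) < b₂ m × b₂ m < b₁ n × b₁ n < b₂ (suc m))
lemma3p4 (suc n) m _ 1≤m step a₁n+1≡a₂m+2 = Sum.map
  (λ gm≡0 → staircase {n} {m} hit step (trans (cong (a₂ m +_) gm≡0) (+-identityʳ (a₂ m)))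
                                (b₁-g≡1 {n} (trans g-flip-n (cong (1 ∸_) gm≡0))))
  (λ gm≡1 → staircase {n} {m} hit step (trans (b₁-g≡0 {n} (trans g-flip-n (cong (1 ∸_) gm≡1)))
                                       (trans (cong (_∸ 1) hit) (m+n∸n≡m (a₂ m) 1)))
                                (trans (cong (a₂ m +_) gm≡1) (sym hit)))
  (gF-binary (suc m) m)
  where
  hit : a₁ n ≡ a₂ m + 1
  hit = +-cancelʳ-≡ 1 (a₁ n) (a₂ m + 1) (trans a₁n+1≡a₂m+2 (sym (+-assoc (a₂ m) 1 1)))
  g-flip-n : g n ≡ 1 ∸ g m
  g-flip-n = g-flip {n} {m} (≤-<-trans 1≤m (a₁≡a₂+1⇒< {n} {m} hit)) hit
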